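{- Let $t$ be a positive integer, let $G$ be a $K_{t,t}$-free graph, and let $X_1,\dots,X_k\subseteq V(G)$ be pairwise disjoint and pairwise complete. Then either $\alpha\left(G\left[\bigcup_{i=1}^k X_i\right]\right)<t$, or there exists $i^*$ such that $\alpha(G[X_{i^*}])\geq t$ and $\alpha\left(G\left[\bigcup_{i\neq i^*}X_i\right]\right)<t$. Consequently, if $Z\subseteq V(G)$ with $|Z|\geq 2$ and $\eta$ is an extended strip decomposition of $(G,Z)$ with pattern $H$, then every vertex of $H$ has at most one special neighbor.
   Context: Graphs are finite and simple; $K_{t,t}$-free means no induced subgraph isomorphic to $K_{t,t}$; sets $A,B$ are complete if every vertex of $A$ is adjacent to every vertex of $B$. Extended strip decomposition: let $G,H$ be graphs, $Z\subseteq V(G)$, $W$ the set of degree-one vertices of $H$, $T(H)$ the set of triangles of $H$. An extended strip decomposition of $(G,Z)$ with pattern $H$ is a map $\eta$ from $E(H)\cup V(H)\cup T(H)\cup\{(e,v): e\in E(H), v \text{ an end of } e\}$ to $2^{V(G)}$ such that: (1) every $v\in V(G)$ lies in $\eta(x)$ for a unique $x\in E(H)\cup V(H)\cup T(H)$; (2) $\eta(e,v)\subseteq\eta(e)$; (3) for distinct $e,f\in E(H)$, $x\in\eta(e)$, $y\in\eta(f)$: $xy\in E(G)$ iff $e,f$ share an end $v$ with $x\in\eta(e,v)$, $y\in\eta(f,v)$; (4) if $v\in V(H)$, $x\in\eta(v)$, $y\notin\eta(v)$, $xy\in E(G)$, then $y\in\eta(e,v)$ for some edge $e$ incident with $v$;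 (5) if $D\in T(H)$, $x\in\eta(D)$, $y\notin\eta(D)$, $xy\in E(G)$, then $y\in\eta(e,u)\cap\eta(e,v)$ for some distinct $u,v\in D$ with $e=uv$; (6) $|Z|=|W|$ and for each $z\in Z$ there is $w\in W$ with $\eta(e,w)=\{z\}$, where $e$ is the edge of $H$ incident with $w$. For $x,y\in V(H)$, $y$ is a special neighbor of $x$ if $xy\in E(H)$ and $\alpha(G[\eta(xy,x)])\geq t$. -}

module Defs where

open import Data.Nat using (ℕ; _≤_; suc; zero)
open import Data.Bool using (Bool; true; false; not)
open import Data.Fin using (Fin) renaming (_<_ to _<ᶠ_)
open import Data.Fin.Subset using (Subset; _∈_; _∉_; _⊆_; ∣_∣; ⁅_⁆; Empty)
open import Data.Vec using (tabulate)
open import Data.Product using (Σ; Σ-syntax; ∃; ∃-syntax; _×_; _,_; proj₁; proj₂)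
open import Data.Sum using (_⊎_)
open import Data.Empty using (⊥)
open import Relation.Nullary using (¬_)
open import Relation.Binary.PropositionalEquality using (_≡_; _≢_)
open import Function.Bundles using (_⇔_)

record Graph (n : ℕ) : Set where
  field
    adj   : Fin n → Fin n → Bool
    sym   : ∀ x y → adj x y ≡ adj y x
    irrefl : ∀ x → adj x x ≡ false
open Graph public

Adj : ∀ {n} → Graph n → Fin n → Fin n → Set
Adj G x y = adj G x y ≡ true

Stable : ∀ {n} → Graph n → Subset n → Set
Stable G S = ∀ x y → x ∈ S → y ∈ S → ¬ Adj G x y

Complete : ∀ {n} → Graph n → Subset n → Subset n → Set
Complete G A B = ∀ x y → x ∈ A → y ∈ B → Adj G x y

-- α(G[P]) ≥ t, where the vertex set P is given by a membership predicate:
-- some stable set of size ≥ t is contained in P.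
AlphaGe : ∀ {n} → Graph n → (Fin n → Set) → ℕ → Set
AlphaGe G P t = Σ[ S ∈ Subset _ ] ((∀ v → v ∈ S → P v) × Stable G S × t ≤ ∣ S ∣)

AlphaLt : ∀ {n} → Graph n → (Fin n → Set) → ℕ → Set
AlphaLt G P t = ¬ AlphaGe G P t

mem : ∀ {n} → Subset n → Fin n → Set
mem S v = v ∈ S

-- G contains an induced K_{t,t}: disjoint stable sets A, B with |A| = |B| = t,
-- complete to each other (then G[A ∪ B] ≅ K_{t,t}).
HasInducedKtt : ∀ {n} → Graph n → ℕ → Set
HasInducedKtt G t = Σ[ A ∈ Subset _ ] Σ[ B ∈ Subset _ ]
  ( ∣ A ∣ ≡ t × ∣ B ∣ ≡ t × (∀ v → v ∈ A → v ∉ B)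
  × Stable G A × Stable G B × Complete G A B )

KttFree : ∀ {n} → Graph n → ℕ → Set
KttFree G t = ¬ HasInducedKtt G t

-- an edge is stored once, as (src , tgt) with src < tgt
record Edge {m : ℕ} (H : Graph m) : Set where
  constructor edge
  field
    src : Fin m
    tgt : Fin m
    src<tgt : src <ᶠ tgt
    isAdj : Adj H src tgt

end : ∀ {m} {H : Graph m} → Edge H → Bool → Fin m
end e false = Edge.src e
end e true  = Edge.tgt e

SameEdge : ∀ {m} {H : Graph m} → Edge H → Edge H → Set
SameEdge e f = end e false ≡ end f false × end e true ≡ end f true

record Triangle {m : ℕ} (H : Graph m) : Set where
  constructor triangle
  field
    corner1 : Fin m
    corner2 : Fin m
    corner3 : Fin m
    lt12 : corner1 <ᶠ corner2
    lt23 : corner2 <ᶠ corner3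
    adj12 : Adj H corner1 corner2
    adj23 : Adj H corner2 corner3
    adj13 : Adj H corner1 corner3
open Triangle public

InTri : ∀ {m} {H : Graph m} → Fin m → Triangle H → Set
InTri v D = v ≡ corner1 D ⊎ v ≡ corner2 D ⊎ v ≡ corner3 D

SameTri : ∀ {m} {H : Graph m} → Triangle H → Triangle H → Set
SameTri D D' = corner1 D ≡ corner1 D' × corner2 D ≡ corner2 D' × corner3 D ≡ corner3 D'

degree : ∀ {m} → Graph m → Fin m → ℕ
degree H w = ∣ tabulate (adj H w) ∣

DegOne : ∀ {m} → Graph m → Fin m → Bool
DegOne H w with degree H w
... | suc zero = true
... | _ = false

W : ∀ {m} → Graph m → Subset m
W H = tabulate (DegOne H)

Piece : ∀ {m} → Graph m → Set
Piece {m} H = Edge H ⊎ Fin m ⊎ Triangle H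

SamePiece : ∀ {m} {H : Graph m} → Piece H → Piece H → Set
SamePiece (_⊎_.inj₁ e) (_⊎_.inj₁ f) = SameEdge e f
SamePiece (_⊎_.inj₂ (_⊎_.inj₁ v)) (_⊎_.inj₂ (_⊎_.inj₁ w)) = v ≡ w
SamePiece (_⊎_.inj₂ (_⊎_.inj₂ D)) (_⊎_.inj₂ (_⊎_.inj₂ D')) = SameTri D D'
SamePiece _ _ = ⊥

pieceSet : ∀ {n m} {H : Graph m} → (Edge H → Subset n) → (Fin m → Subset n) →
  (Triangle H → Subset n) → Piece H → Subset n
pieceSet ηE ηV ηT (_⊎_.inj₁ e) = ηE e
pieceSet ηE ηV ηT (_⊎_.inj₂ (_⊎_.inj₁ v)) = ηV v
pieceSet ηE ηV ηT (_⊎_.inj₂ (_⊎_.inj₂ D)) = ηT D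

record ESD {n m : ℕ} (G : Graph n) (Z : Subset n) (H : Graph m) : Set where
  field
    ηE   : Edge H → Subset n
    ηV   : Fin m → Subset n
    ηT   : Triangle H → Subset n
    ηEnd : Edge H → Bool → Subset n     -- η(e , end e b)

  field
    cover  : ∀ x → Σ[ p ∈ Piece H ] x ∈ pieceSet ηE ηV ηT p
    unique : ∀ x p q → x ∈ pieceSet ηE ηV ηT p → x ∈ pieceSet ηE ηV ηT q → SamePiece p q
    endSub : ∀ e b → ηEnd e b ⊆ ηE e
    edgeAdj : ∀ e f → ¬ SameEdge e f → ∀ x y → x ∈ ηE e → y ∈ ηE f →
      (Adj G x y ⇔ (Σ[ b ∈ Bool ] Σ[ b' ∈ Bool ]
                     (end e b ≡ end f b' × x ∈ ηEnd e b × y ∈ ηEnd f b')))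
    vertexAdj : ∀ v x y → x ∈ ηV v → y ∉ ηV v → Adj G x y →
      Σ[ e ∈ Edge H ] Σ[ b ∈ Bool ] (end e b ≡ v × y ∈ ηEnd e b)
    triAdj : ∀ D x y → x ∈ ηT D → y ∉ ηT D → Adj G x y →
      Σ[ e ∈ Edge H ] (InTri (end e false) D × InTri (end e true) D
                        × y ∈ ηEnd e false × y ∈ ηEnd e true)
    sizeZ : ∣ Z ∣ ≡ ∣ W H ∣
    leafZ : ∀ z → z ∈ Z → Σ[ w ∈ Fin m ] (w ∈ W H ×
      Σ[ e ∈ Edge H ] Σ[ b ∈ Bool ] (end e b ≡ w × ηEnd e b ≡ ⁅ z ⁆))
open ESD public

SpecialNeighbor : ∀ {n m} {G : Graph n} {Z : Subset n} {H : Graph m} →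
  ESD G Z H → ℕ → Fin m → Fin m → Set
SpecialNeighbor {G = G} η t x y =
  Σ[ e ∈ Edge _ ] Σ[ b ∈ Bool ]
    (end e b ≡ x × end e (not b) ≡ y × AlphaGe G (mem (ηEnd η e b)) t)

{-# OPTIONS --safe #-}
-- Shrinking two stable t-sets lying in disjoint, mutually complete vertex sets to
-- size exactly t yields an induced K_{t,t}.  A stable set inside a union of
-- pairwise complete parts lies in a single part, since vertices in different
-- parts are adjacent; so a stable t-set of the union sits in some X_{i*}, and a
-- stable t-set avoiding X_{i*} would sit in another part, complete to X_{i*}.
-- If x had special neighbours y ≠ y', then η(xy, x) and η(xy', x) would be such
-- a pair of sets: disjoint by axiom (1) and complete by axiom (3).
module Submission where

open import Defs hiding (sym)
open import Data.Nat using (ℕ; suc; s≤s; _≤_; _≤?_)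
open import Data.Nat.Properties using (≤-trans)
open import Data.Bool using (true; false; not) renaming (_≟_ to _≟ᵇ_)
open import Data.Fin using (Fin) renaming (zero to fzero; suc to fsuc)
open import Data.Fin.Properties using (any?; all?; <⇒≢) renaming (_≟_ to _≟ᶠ_)
open import Data.Fin.Subset
  using (Subset; _∈_; _∉_; _⊆_; ∣_∣; Empty; Nonempty; _∩_; inside; outside) renaming (⊥ to ∅)
open import Data.Fin.Subset.Properties using (_∈?_; anySubset?; out⊆; s⊆s; ⊥⊆; ∣⊥∣≡0; x∈p∩q⁺)
open import Data.Vec using (_∷_; here; there)
open import Data.Product using (Σ-syntax; ∃-syntax; _×_; _,_; proj₂; map; map₁; map₂)
open import Data.Sum using (_⊎_; inj₁; inj₂)
open import Data.Unit using (⊤; tt)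
open import Data.Empty using (⊥-elim)
open import Function using (_∘_)
open import Function.Bundles using (Equivalence)
open import Relation.Nullary using (¬_; Dec; yes; no)
open import Relation.Nullary.Decidable using (_×-dec_; _→-dec_; ¬?)
open import Relation.Unary using (Decidable)
open import Relation.Binary.PropositionalEquality
  using (_≡_; _≢_; refl; sym; trans; cong; module ≡-Reasoning)

subset-of-size : ∀ {n} t (p : Subset n) → t ≤ ∣ p ∣ → ∃[ q ] (q ⊆ p × ∣ q ∣ ≡ t)
subset-of-size {n} 0 p _ = ∅ , ⊥⊆ , ∣⊥∣≡0 n
subset-of-size t (outside ∷ p) t≤∣p∣ = map (outside ∷_) (map₁ out⊆) (subset-of-size t p t≤∣p∣)
subset-of-size (suc t) (inside ∷ p) (s≤s t≤∣p∣) =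
  map (inside ∷_) (map s⊆s (cong suc)) (subset-of-size t p t≤∣p∣)

∣p∣≥1⇒Nonempty : ∀ {n} (p : Subset n) → 1 ≤ ∣ p ∣ → Nonempty p
∣p∣≥1⇒Nonempty (inside ∷ p) _ = fzero , here
∣p∣≥1⇒Nonempty (outside ∷ p) 1≤∣p∣ = map fsuc there (∣p∣≥1⇒Nonempty p 1≤∣p∣)

module _ {n : ℕ} (G : Graph n) where

  stable? : Decidable (Stable G)
  stable? S = all? λ x → all? λ y → x ∈? S →-dec (y ∈? S →-dec ¬? (adj G x y ≟ᵇ true))

  alphaGe? : ∀ {P : Fin n → Set} → Decidable P → ∀ t → Dec (AlphaGe G P t)
  alphaGe? P? t = anySubset? λ S → all? (λ v → v ∈? S →-dec P? v) ×-dec stable? S ×-dec t ≤? ∣ S ∣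

  AlphaGe-mono : ∀ {P Q : Fin n → Set} {t} → (∀ v → P v → Q v) → AlphaGe G P t → AlphaGe G Q t
  AlphaGe-mono P⇒Q (S , S⊆P , stable , t≤∣S∣) = S , (λ v → P⇒Q v ∘ S⊆P v) , stable , t≤∣S∣

  disjoint-complete-AlphaGe⇒Ktt : ∀ {t} {A B : Subset n} →
    (∀ v → v ∈ A → v ∉ B) → Complete G A B →
    AlphaGe G (mem A) t → AlphaGe G (mem B) t → HasInducedKtt G t
  disjoint-complete-AlphaGe⇒Ktt {t} disjoint complete
    (S , S⊆A , S-stable , t≤∣S∣) (S' , S'⊆B , S'-stable , t≤∣S'∣)
    with subset-of-size t S t≤∣S∣ | subset-of-size t S' t≤∣S'∣
  ... | K , K⊆S , ∣K∣≡t | K' , K'⊆S' , ∣K'∣≡t =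
    K , K' , ∣K∣≡t , ∣K'∣≡t
    , (λ v v∈K → disjoint v (S⊆A v (K⊆S v∈K)) ∘ S'⊆B v ∘ K'⊆S')
    , (λ x y x∈K y∈K → S-stable x y (K⊆S x∈K) (K⊆S y∈K))
    , (λ x y x∈K' y∈K' → S'-stable x y (K'⊆S' x∈K') (K'⊆S' y∈K'))
    , (λ x y x∈K y∈K' → complete x y (S⊆A x (K⊆S x∈K)) (S'⊆B y (K'⊆S' y∈K')))

  module _ {I : Set} (X : I → Subset n) (complete : ∀ i j → i ≢ j → Complete G (X i) (X j)) where

    stable⊆part : ∀ {S} → Stable G S → (∀ u → u ∈ S → ∃[ j ] u ∈ X j) →
      ∀ {v i} → v ∈ S → v ∈ X i → S ⊆ X i
    stable⊆part stable S⊆⋃X {v} {i} v∈S v∈Xi {u} u∈S with S⊆⋃X u u∈S | u ∈? X i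
    ... | _ , _ | yes u∈Xi = u∈Xi
    ... | j , u∈Xj | no u∉Xi =
      ⊥-elim (stable u v u∈S v∈S (complete j i (λ { refl → u∉Xi u∈Xj }) u v u∈Xj v∈Xi))

    AlphaGe-⋃⇒AlphaGe-part : ∀ {t} (Q : I → Set) → 1 ≤ t →
      AlphaGe G (λ v → ∃[ i ] (Q i × v ∈ X i)) t → ∃[ i ] (Q i × AlphaGe G (mem (X i)) t)
    AlphaGe-⋃⇒AlphaGe-part Q 1≤t (S , S⊆⋃X , stable , t≤∣S∣)
      with ∣p∣≥1⇒Nonempty S (≤-trans 1≤t t≤∣S∣)
    ... | w , w∈S with S⊆⋃X w w∈S
    ... | i , Qi , w∈Xi = i , Qi , S , (λ _ → S⊆Xi) , stable , t≤∣S∣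
      where
      S⊆Xi : S ⊆ X i
      S⊆Xi = stable⊆part stable (λ u → map₂ proj₂ ∘ S⊆⋃X u) w∈S w∈Xi

module _ {m : ℕ} {H : Graph m} where

  sameEdge? : (e f : Edge H) → Dec (SameEdge e f)
  sameEdge? e f = (Edge.src e ≟ᶠ Edge.src f) ×-dec (Edge.tgt e ≟ᶠ Edge.tgt f)

  end-injective : (e : Edge H) → ∀ {b b'} → end e b ≡ end e b' → b ≡ b'
  end-injective e {false} {false} _ = refl
  end-injective e {false} {true}  src≡tgt = ⊥-elim (<⇒≢ (Edge.src<tgt e) src≡tgt)
  end-injective e {true}  {false} tgt≡src = ⊥-elim (<⇒≢ (Edge.src<tgt e) (sym tgt≡src))
  end-injective e {true}  {true}  _ = refl

  SameEdge⇒end≡ : ∀ {e f : Edge H} → SameEdge e f → ∀ b → end e b ≡ end f b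
  SameEdge⇒end≡ (src≡src , _) false = src≡src
  SameEdge⇒end≡ (_ , tgt≡tgt) true  = tgt≡tgt

  SameEdge⇒other-end≡ : ∀ {e f : Edge H} → SameEdge e f → ∀ {b b'} →
    end e b ≡ end f b' → end e (not b) ≡ end f (not b')
  SameEdge⇒other-end≡ {f = f} same {b} {b'} eb≡fb'
    with end-injective f {b} {b'} (trans (sym (SameEdge⇒end≡ same b)) eb≡fb')
  ... | refl = SameEdge⇒end≡ same (not b)

module _ {n m : ℕ} {G : Graph n} {Z : Subset n} {H : Graph m} (η : ESD G Z H) where

  ηEnd-disjoint : ∀ {e f} → ¬ SameEdge e f → ∀ b b' v → v ∈ ηEnd η e b → v ∉ ηEnd η f b'
  ηEnd-disjoint {e} {f} ¬same b b' v v∈e v∈f =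
    ¬same (unique η v (inj₁ e) (inj₁ f) (endSub η e b v∈e) (endSub η f b' v∈f))

  ηEnd-complete : ∀ {e f} → ¬ SameEdge e f → ∀ {b b'} → end e b ≡ end f b' →
    Complete G (ηEnd η e b) (ηEnd η f b')
  ηEnd-complete {e} {f} ¬same {b} {b'} eb≡fb' x y x∈e y∈f =
    Equivalence.from (edgeAdj η e f ¬same x y (endSub η e b x∈e) (endSub η f b' y∈f))
      (b , b' , eb≡fb' , x∈e , y∈f)

  special-neighbour-unique : ∀ {t} → KttFree G t →
    ∀ x y y' → SpecialNeighbor η t x y → SpecialNeighbor η t x y' → y ≡ y'
  special-neighbour-unique free _ y y'
    (e , b , eb≡x , e¬b≡y , α≥t) (f , b' , fb'≡x , f¬b'≡y' , α'≥t)
    with sameEdge? e f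
  ... | yes same = begin
    y              ≡⟨ sym e¬b≡y ⟩
    end e (not b)  ≡⟨ SameEdge⇒other-end≡ same {b} {b'} eb≡fb' ⟩
    end f (not b') ≡⟨ f¬b'≡y' ⟩
    y'             ∎
    where open ≡-Reasoning
          eb≡fb' = trans eb≡x (sym fb'≡x)
  ... | no ¬same = ⊥-elim (free (disjoint-complete-AlphaGe⇒Ktt G
    (ηEnd-disjoint ¬same b b') (ηEnd-complete ¬same (trans eb≡x (sym fb'≡x))) α≥t α'≥t))

module _ {n : ℕ} (G : Graph n) {t : ℕ} (1≤t : 1 ≤ t) (free : KttFree G t) where

  AlphaLt-⋃⊎unique-AlphaGe-part : (k : ℕ) (X : Fin k → Subset n) →
    (∀ i j → i ≢ j → Empty (X i ∩ X j)) →
    (∀ i j → i ≢ j → Complete G (X i) (X j)) →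
    AlphaLt G (λ v → Σ[ i ∈ Fin k ] v ∈ X i) t
    ⊎ Σ[ i* ∈ Fin k ] (AlphaGe G (mem (X i*)) t
        × AlphaLt G (λ v → Σ[ i ∈ Fin k ] (i ≢ i* × v ∈ X i)) t)
  AlphaLt-⋃⊎unique-AlphaGe-part k X disjoint complete
    with alphaGe? G (λ v → any? λ i → v ∈? X i) t
  ... | no α<t = inj₁ α<t
  ... | yes α≥t
    with AlphaGe-⋃⇒AlphaGe-part G X complete (λ _ → ⊤) 1≤t (AlphaGe-mono G (λ _ → map₂ (tt ,_)) α≥t)
  ... | i* , _ , αi*≥t = inj₂ (i* , αi*≥t , rest<t)
    where
    rest<t : AlphaLt G (λ v → Σ[ i ∈ Fin k ] (i ≢ i* × v ∈ X i)) t
    rest<t α'≥t with AlphaGe-⋃⇒AlphaGe-part G X complete (_≢ i*) 1≤t α'≥t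
    ... | j , j≢i* , αj≥t = free (disjoint-complete-AlphaGe⇒Ktt G
      (λ v v∈Xi* v∈Xj → disjoint i* j (j≢i* ∘ sym) (v , x∈p∩q⁺ (v∈Xi* , v∈Xj)))
      (complete i* j (j≢i* ∘ sym)) αi*≥t αj≥t)

lemma4p5 : (t : ℕ) → 1 ≤ t → (n : ℕ) (G : Graph n) → KttFree G t →
    ( ((k : ℕ) (X : Fin k → Subset n) →
        (∀ i j → i ≢ j → Empty (X i ∩ X j)) →
        (∀ i j → i ≢ j → Complete G (X i) (X j)) →
        AlphaLt G (λ v → Σ[ i ∈ Fin k ] v ∈ X i) t
        ⊎ Σ[ i* ∈ Fin k ] (AlphaGe G (mem (X i*)) t
            × AlphaLt G (λ v → Σ[ i ∈ Fin k ] (i ≢ i* × v ∈ X i)) t))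
    × ((m : ℕ) (H : Graph m) (Z : Subset n) → 2 ≤ ∣ Z ∣ → (η : ESD G Z H) →
        ∀ x y y' → SpecialNeighbor η t x y → SpecialNeighbor η t x y' → y ≡ y') )
lemma4p5 t 1≤t n G free =
  AlphaLt-⋃⊎unique-AlphaGe-part G 1≤t free ,
  λ m H Z _ η → special-neighbour-unique η free
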